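{- For every graph $G$ and positive integers $m,r$ with $|V(G)|\ge r-m+1\ge\lfloor r/m\rfloor\ge 1$, we have $\sigma(G,m,r)\le\gamma(G)\lfloor r/m\rfloor$, where $\gamma(G)$ is the domination number of $G$.
   Context: The game $\mathrm{RS}(G,m,r,s)$ is played on a finite graph $G$ by $r$ revolutionaries and $s$ spies. First each revolutionary occupies a vertex, then each spy occupies a vertex (several players may share a vertex). In each subsequent round, each revolutionary may move to an adjacent vertex or stay put, and then each spy may move to an adjacent vertex or stay put; all positions are known to all players. The revolutionaries win if at the end of some round (the initial placement counts as a round) some vertex holds at least $m$ revolutionaries and no spy; the spies win if this never happens. $\sigma(G,m,r)$ denotes the minimum $s$ such that the spies have a winning strategy in $\mathrm{RS}(G,m,r,s)$. The domination number $\gamma(G)$ is the minimum size of a set $S\subseteq V(G)$ such that every vertex outside $S$ has a neighbor in $S$. -}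

module Defs where

open import Data.Nat using (ℕ; zero; suc; _≤_; _<_)
open import Data.Fin using (Fin) renaming (_≟_ to _≟ᶠ_)
open import Data.Fin.Subset using (Subset; _∈_; ∣_∣)
open import Data.List using (List; []; _∷_; length; filter; allFin)
open import Data.Product using (Σ; _×_; _,_; proj₁; proj₂; ∃)
open import Data.Sum using (_⊎_)
open import Data.Empty using (⊥)
open import Relation.Nullary using (¬_)
open import Relation.Binary.PropositionalEquality using (_≡_; _≢_)

record Graph : Set₁ where
  field
    n     : ℕ
    Adj   : Fin n → Fin n → Set
    sym   : ∀ {u v} → Adj u v → Adj v u
    irrefl : ∀ {u} → ¬ Adj u u

module _ (G : Graph) where
  open Graph G

  V : Set
  V = Fin n

  IsDominating : Subset n → Set
  IsDominating S = ∀ v → ¬ (v ∈ S) → Σ V λ u → u ∈ S × Adj u v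

  IsDominationNumber : ℕ → Set
  IsDominationNumber g =
    (Σ (Subset n) λ S → IsDominating S × ∣ S ∣ ≡ g)
    × (∀ S → IsDominating S → g ≤ ∣ S ∣)

  Pos : ℕ → Set
  Pos k = Fin k → V

  LegalMove : ∀ {k} → Pos k → Pos k → Set
  LegalMove P P' = ∀ i → P' i ≡ P i ⊎ Adj (P i) (P' i)

  module Game (m r s : ℕ) where

    Config : Set
    Config = Pos r × Pos s

    revCount : Pos r → V → ℕ
    revCount R v = length (filter (λ i → R i ≟ᶠ v) (allFin r))

    RevWin : Config → Set
    RevWin (R , S) = Σ V λ v → (m ≤ revCount R v) × (∀ j → S j ≢ v)

    -- A (history-dependent) spy strategy: given the initial revolutionary
    -- placement, choose the spies' placement; in each later round, given
    -- the past configurations, the current configuration and the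
    -- revolutionaries' new positions, choose the spies' new positions.
    record Strategy : Set where
      field
        init  : Pos r → Pos s
        step  : List Config → Config → Pos r → Pos s
        legal : ∀ past c R' → LegalMove (proj₁ c) R' →
                LegalMove (proj₂ c) (step past c R')

    open Strategy

    state : Strategy → (ℕ → Pos r) → ℕ → Config × List Config
    state σ ρ zero = (ρ zero , init σ (ρ zero)) , []
    state σ ρ (suc t) with state σ ρ t
    ... | c , past = (ρ (suc t) , step σ past c (ρ (suc t))) , c ∷ past

    SpiesWin : Set
    SpiesWin = Σ Strategy λ σ →
      ∀ (ρ : ℕ → Pos r) → (∀ t → LegalMove (ρ t) (ρ (suc t))) →
      ∀ t → ¬ RevWin (proj₁ (state σ ρ t))

  IsSigma : ℕ → ℕ → ℕ → Set
  IsSigma m r s = Game.SpiesWin m r s × (∀ s' → s' < s → ¬ Game.SpiesWin m r s')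

module Submission where

-- Corollary 3.4: σ(G,m,r) ≤ γ(G)·⌊r/m⌋; of the hypotheses only ⌊r/m⌋ ≥ 1 is used.
--
-- Put k = ⌊r/m⌋ spies on each vertex of a minimum dominating set D, and assign
-- to every vertex v a dominator `region v` equal or adjacent to it. Call a
-- vertex heavy if it holds at least m revolutionaries. Team j keeps the
-- invariant that each of its spies is at home (its dominator) or on a distinct
-- heavy vertex of its region, and that it occupies every heavy vertex of its
-- region. After the revolutionaries move, Hall's theorem matches the new heavy
-- vertices of the region to spies able to reach them (from home, or by
-- following a revolutionary); Hall's condition holds by a counting argument
-- using r < m·(k + 1). Unmatched spies return home. So no heavy vertex is
-- ever unguarded, γ(G)·k spies win, and minimality of σ gives the bound.

open import Defs
open import Data.Bool using (Bool; true; false; _∧_; _∨_; not; if_then_else_)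
import Data.Bool.Properties as Bool
open import Data.Empty using (⊥; ⊥-elim)
open import Data.Fin using (Fin; zero; suc; _≟_; combine; remQuot; fromℕ<)
import Data.Fin.Properties as Fin
open import Data.Fin.Subset using (Subset; _∈_; ∣_∣; inside; outside)
open import Data.Fin.Subset.Properties using (_∈?_; anySubset?)
open import Data.List using (filter; length)
import Data.List as List
open import Data.Nat using (ℕ; zero; suc; _+_; _*_; _∸_; _/_; _%_; _≤_; _<_; _≤?_; _<?_; z≤n; s≤s; NonZero)
  renaming (_≟_ to _≟ℕ_)
open import Data.Nat.DivMod using (m≡m%n+[m/n]*n; m%n<n)
open import Data.Nat.Properties hiding (_≟_)
open import Data.Product using (Σ; ∃; _×_; _,_; proj₁; proj₂)
open import Data.Sum using (_⊎_; inj₁; inj₂)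
open import Data.Vec using ([]; _∷_; there; lookup; tabulate)
open import Data.Vec.Properties using (lookup∘tabulate)
open import Function using (_∘_)
open import Relation.Binary.PropositionalEquality
open import Relation.Nullary using (¬_; Dec; yes; no; does)
open import Relation.Nullary.Decidable using (dec-true; _×-dec_; _→-dec_; ¬?; decidable-stable)
open import Relation.Unary using (Pred; Decidable)

open import Algebra.Properties.CommutativeSemigroup +-commutativeSemigroup using (interchange)

∧-true⁻ : ∀ {a b} → a ∧ b ≡ true → a ≡ true × b ≡ true
∧-true⁻ {true} {true} _ = refl , refl

∧-true : ∀ {a b} → a ≡ true → b ≡ true → a ∧ b ≡ true
∧-true refl refl = refl

∨-true⁻ : ∀ {a b} → a ∨ b ≡ true → a ≡ true ⊎ b ≡ true
∨-true⁻ {true} _ = inj₁ refl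
∨-true⁻ {false} e = inj₂ e

∨-trueˡ : ∀ {a b} → a ≡ true → a ∨ b ≡ true
∨-trueˡ refl = refl

∨-trueʳ : ∀ {a b} → b ≡ true → a ∨ b ≡ true
∨-trueʳ {true} _ = refl
∨-trueʳ {false} e = e

not-true⁻ : ∀ {a} → not a ≡ true → ¬ (a ≡ true)
not-true⁻ {true} () _

not-true : ∀ {a} → ¬ (a ≡ true) → not a ≡ true
not-true {true} h = ⊥-elim (h refl)
not-true {false} _ = refl

bool-ext : ∀ {a b} → (a ≡ true → b ≡ true) → (b ≡ true → a ≡ true) → a ≡ b
bool-ext {true} {true} _ _ = refl
bool-ext {true} {false} f _ = sym (f refl)
bool-ext {false} {true} _ g = g refl
bool-ext {false} {false} _ _ = refl

decided : ∀ {A : Set} (d : Dec A) → does d ≡ true → A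
decided (yes a) _ = a

Sub : ℕ → Set
Sub n = Fin n → Bool

_⊆_ : ∀ {n} → Sub n → Sub n → Set
P ⊆ Q = ∀ x → P x ≡ true → Q x ≡ true

_∩_ _∪_ _∖_ : ∀ {n} → Sub n → Sub n → Sub n
(P ∩ Q) x = P x ∧ Q x
(P ∪ Q) x = P x ∨ Q x
(P ∖ Q) x = P x ∧ not (Q x)

full : ∀ {n} → Sub n
full _ = true

_≟ᵇ_ : ∀ {n} → Fin n → Fin n → Bool
x ≟ᵇ y = does (x ≟ y)

⁅_⁆ : ∀ {n} → Fin n → Sub n
⁅ x ⁆ y = y ≟ᵇ x

≟ᵇ-sound : ∀ {n} {x y : Fin n} → x ≟ᵇ y ≡ true → x ≡ y
≟ᵇ-sound {x = x} {y} = decided (x ≟ y)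

≟ᵇ-refl : ∀ {n} (x : Fin n) → x ≟ᵇ x ≡ true
≟ᵇ-refl x = dec-true (x ≟ x) refl

bit : Bool → ℕ
bit true = 1
bit false = 0

count : ∀ {n} → Sub n → ℕ
count {zero} P = 0
count {suc n} P = bit (P zero) + count (P ∘ suc)

some : ∀ {n} → Sub n → Bool
some {zero} P = false
some {suc n} P = P zero ∨ some (P ∘ suc)

some-witness : ∀ {n} (P : Sub n) → some P ≡ true → ∃ λ x → P x ≡ true
some-witness {suc n} P h with P zero in e
... | true = zero , e
... | false = let x , px = some-witness (P ∘ suc) h in suc x , px

some-intro : ∀ {n} (P : Sub n) x → P x ≡ true → some P ≡ true
some-intro P zero e = ∨-trueˡ e
some-intro P (suc x) e = ∨-trueʳ {P zero} (some-intro (P ∘ suc) x e)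

some-ext : ∀ {n} {P Q : Sub n} → P ≗ Q → some P ≡ some Q
some-ext {zero} _ = refl
some-ext {suc n} h = cong₂ _∨_ (h zero) (some-ext (h ∘ suc))

count-ext : ∀ {n} {P Q : Sub n} → P ≗ Q → count P ≡ count Q
count-ext {zero} _ = refl
count-ext {suc n} h = cong₂ _+_ (cong bit (h zero)) (count-ext (h ∘ suc))

count-mono : ∀ {n} {P Q : Sub n} → P ⊆ Q → count P ≤ count Q
count-mono {zero} _ = z≤n
count-mono {suc n} {P} {Q} h = +-mono-≤ (bit-mono (h zero)) (count-mono (h ∘ suc))
  where
  bit-mono : ∀ {a b} → (a ≡ true → b ≡ true) → bit a ≤ bit b
  bit-mono {false} _ = z≤n
  bit-mono {true} f rewrite f refl = ≤-refl

count-≤ : ∀ {n} (P : Sub n) → count P ≤ n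
count-≤ {zero} P = z≤n
count-≤ {suc n} P with P zero
... | true = s≤s (count-≤ (P ∘ suc))
... | false = m≤n⇒m≤1+n (count-≤ (P ∘ suc))

count-full : ∀ n → count (full {n}) ≡ n
count-full zero = refl
count-full (suc n) = cong suc (count-full n)

count-∪ : ∀ {n} (P Q : Sub n) → (∀ x → P x ≡ true → ¬ (Q x ≡ true)) →
  count (P ∪ Q) ≡ count P + count Q
count-∪ {zero} P Q _ = refl
count-∪ {suc n} P Q h =
  trans (cong₂ _+_ (bit-∨ (P zero) (Q zero) (h zero)) (count-∪ (P ∘ suc) (Q ∘ suc) (h ∘ suc)))
        (interchange (bit (P zero)) (bit (Q zero)) (count (P ∘ suc)) (count (Q ∘ suc)))
  where
  bit-∨ : ∀ a b → (a ≡ true → ¬ (b ≡ true)) → bit (a ∨ b) ≡ bit a + bit b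
  bit-∨ true true h = ⊥-elim (h refl refl)
  bit-∨ true false _ = refl
  bit-∨ false b _ = refl

count-split : ∀ {n} (P Q : Sub n) → count P ≡ count (P ∩ Q) + count (P ∖ Q)
count-split P Q =
  trans (count-ext pieces)
        (count-∪ (P ∩ Q) (P ∖ Q) λ x a b → not-true⁻ (proj₂ (∧-true⁻ {P x} b)) (proj₂ (∧-true⁻ {P x} a)))
  where
  pieces : P ≗ (P ∩ Q) ∪ (P ∖ Q)
  pieces x with P x | Q x
  ... | true | true = refl
  ... | true | false = refl
  ... | false | _ = refl

count-complement : ∀ {n} {S T : Sub n} → S ⊆ T → count T ≡ count S + count (T ∖ S)
count-complement {S = S} {T} S⊆T =
  trans (count-split T S) (cong (_+ count (T ∖ S)) (count-ext T∩S≗S))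
  where
  T∩S≗S : (T ∩ S) ≗ S
  T∩S≗S x = bool-ext (proj₂ ∘ ∧-true⁻ {T x}) λ s → ∧-true (S⊆T x s) s

count-witness : ∀ {n} (P : Sub n) → 0 < count P → ∃ λ x → P x ≡ true
count-witness {suc n} P h with P zero in e
... | true = zero , e
... | false = let x , px = count-witness (P ∘ suc) h in suc x , px

count-member : ∀ {n} (P : Sub n) x → P x ≡ true → 0 < count P
count-member P zero e rewrite e = s≤s z≤n
count-member P (suc x) e = ≤-trans (count-member (P ∘ suc) x e) (m≤n+m _ (bit (P zero)))

count-singleton : ∀ {n} (x : Fin n) → count ⁅ x ⁆ ≡ 1
count-singleton {suc n} zero = cong suc (count-empty n)
  where
  count-empty : ∀ n → count {n} (λ _ → false) ≡ 0
  count-empty zero = refl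
  count-empty (suc n) = count-empty n
count-singleton {suc n} (suc x) = count-singleton x

count-remove : ∀ {n} (P : Sub n) x → P x ≡ true → count P ≡ suc (count (P ∖ ⁅ x ⁆))
count-remove P x px =
  trans (count-split P ⁅ x ⁆) (cong (_+ count (P ∖ ⁅ x ⁆)) (trans (count-ext only-x) (count-singleton x)))
  where
  only-x : P ∩ ⁅ x ⁆ ≗ ⁅ x ⁆
  only-x y with y ≟ x
  ... | yes refl = cong (_∧ true) px
  ... | no _ = Bool.∧-zeroʳ (P y)

count-injection : ∀ {a b} (P : Sub a) (Q : Sub b) (f : Fin a → Fin b) →
  (∀ x → P x ≡ true → Q (f x) ≡ true) →
  (∀ x y → P x ≡ true → P y ≡ true → f x ≡ f y → x ≡ y) →
  count P ≤ count Q
count-injection {zero} P Q f _ _ = z≤n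
count-injection {suc a} P Q f into inj with P zero in p0
... | false = count-injection (P ∘ suc) Q (f ∘ suc) (into ∘ suc) (λ x y px py → Fin.suc-injective ∘ inj _ _ px py)
... | true = begin
  suc (count (P ∘ suc))              ≤⟨ s≤s (count-injection (P ∘ suc) Q′ (f ∘ suc) into′ inj′) ⟩
  suc (count Q′)                     ≡⟨ count-remove Q (f zero) (into zero p0) ⟨
  count Q                            ∎
  where
  open ≤-Reasoning
  Q′ = Q ∖ ⁅ f zero ⁆
  into′ : ∀ x → P (suc x) ≡ true → Q′ (f (suc x)) ≡ true
  into′ x px = ∧-true (into (suc x) px)
    (not-true λ e → Fin.0≢1+n (sym (inj (suc x) zero px p0 (≟ᵇ-sound e))))
  inj′ : ∀ x y → P (suc x) ≡ true → P (suc y) ≡ true → f (suc x) ≡ f (suc y) → x ≡ y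
  inj′ x y px py = Fin.suc-injective ∘ inj _ _ px py

count-fibres : ∀ {a b} (φ : Fin a → Fin b) (Q : Sub b) (M : ℕ) →
  (∀ v → Q v ≡ true → M ≤ count (λ x → φ x ≟ᵇ v)) →
  M * count Q ≤ count (Q ∘ φ)
count-fibres φ Q M fibres = by-size (count Q) Q refl fibres
  where
  by-size : ∀ c (Q : Sub _) → count Q ≡ c → (∀ v → Q v ≡ true → M ≤ count (λ x → φ x ≟ᵇ v)) →
            M * count Q ≤ count (Q ∘ φ)
  by-size zero Q |Q|≡0 _ rewrite |Q|≡0 | *-zeroʳ M = z≤n
  by-size (suc c) Q |Q|≡1+c fibres = begin
    M * count Q                                    ≡⟨ cong (M *_) (count-remove Q v qv) ⟩
    M * suc (count Q′)                             ≡⟨ *-suc M (count Q′) ⟩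
    M + M * count Q′                               ≤⟨ +-mono-≤ (≤-trans (fibres v qv) (count-mono fibre-v)) rest ⟩
    count ((Q ∘ φ) ∩ (⁅ v ⁆ ∘ φ)) + count (Q′ ∘ φ) ≡⟨ count-split (Q ∘ φ) (⁅ v ⁆ ∘ φ) ⟨
    count (Q ∘ φ)                                  ∎
    where
    open ≤-Reasoning
    witness = count-witness Q (subst (0 <_) (sym |Q|≡1+c) (s≤s z≤n))
    v = proj₁ witness
    qv = proj₂ witness
    Q′ = Q ∖ ⁅ v ⁆
    fibre-v : (λ x → φ x ≟ᵇ v) ⊆ ((Q ∘ φ) ∩ (⁅ v ⁆ ∘ φ))
    fibre-v x e = ∧-true (subst (λ w → Q w ≡ true) (sym (≟ᵇ-sound e)) qv) e
    rest : M * count Q′ ≤ count (Q′ ∘ φ)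
    rest = by-size c Q′ (suc-injective (trans (sym (count-remove Q v qv)) |Q|≡1+c))
                   (λ w q′ → fibres w (proj₁ (∧-true⁻ {Q w} q′)))

length-filter : ∀ {A : Set} {n p} (f : Fin n → A) {P : Pred A p} (P? : Decidable P) →
  length (filter P? (List.tabulate f)) ≡ count (λ i → does (P? (f i)))
length-filter {n = zero} f P? = refl
length-filter {n = suc n} f P? with does (P? (f zero))
... | true = cong suc (length-filter (f ∘ suc) P?)
... | false = length-filter (f ∘ suc) P?

-- Quantifiers over all subsets of Fin n are decidable for properties that
-- respect pointwise equality (decided through `Subset n`, the vector form).
Respects≗ : ∀ {n} → (Sub n → Set) → Set
Respects≗ P = ∀ {X Y} → X ≗ Y → P X → P Y

∃Sub? : ∀ {n} {P : Sub n → Set} → Respects≗ P → (∀ X → Dec (P X)) → Dec (∃ P)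
∃Sub? resp P? with anySubset? (P? ∘ lookup)
... | yes (X , p) = yes (lookup X , p)
... | no ¬p = no λ (X , p) → ¬p (tabulate X , resp (sym ∘ lookup∘tabulate X) p)

∀Sub? : ∀ {n} {P : Sub n → Set} → Respects≗ P → (∀ X → Dec (P X)) → Dec (∀ X → P X)
∀Sub? {P = P} resp P? with ∃Sub? {P = λ X → ¬ P X} (λ X≗Y ¬p p → ¬p (resp (sym ∘ X≗Y) p)) (¬? ∘ P?)
... | yes (X , ¬p) = no λ all → ¬p (all X)
... | no ¬ex = yes λ X → decidable-stable (P? X) λ ¬p → ¬ex (X , ¬p)

_⊆?_ : ∀ {n} (P Q : Sub n) → Dec (P ⊆ Q)
P ⊆? Q = Fin.all? λ x → (P x Bool.≟ true) →-dec (Q x Bool.≟ true)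

-- The default right vertex d₀ fills in the matching outside T.
module Hall {N k : ℕ} (E : Fin N → Fin k → Bool) (d₀ : Fin k) where

  nbhd : Sub N → Sub k
  nbhd P i = some (λ w → P w ∧ E w i)

  nbhd-mono : ∀ {P Q} → P ⊆ Q → nbhd P ⊆ nbhd Q
  nbhd-mono P⊆Q i e =
    let w , pe = some-witness _ e ; p , ew = ∧-true⁻ pe
    in some-intro _ w (∧-true (P⊆Q w p) ew)

  nbhd-∪ : ∀ P Q → nbhd (P ∪ Q) ⊆ (nbhd P ∪ nbhd Q)
  nbhd-∪ P Q i e with some-witness _ e
  ... | w , pe with ∧-true⁻ {(P ∪ Q) w} pe
  ... | pq , ew with ∨-true⁻ {P w} pq
  ... | inj₁ p = ∨-trueˡ (some-intro _ w (∧-true p ew))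
  ... | inj₂ q = ∨-trueʳ {nbhd P i} (some-intro _ w (∧-true q ew))

  nbhd-resp : ∀ {P Q} → P ≗ Q → nbhd P ≗ nbhd Q
  nbhd-resp P≗Q i = some-ext λ w → cong (_∧ E w i) (P≗Q w)

  HallCondition : Sub N → Sub k → Set
  HallCondition T A = ∀ Y → Y ⊆ T → count Y ≤ count (A ∩ nbhd Y)

  record Matching (T : Sub N) (A : Sub k) : Set where
    field
      match     : Fin N → Fin k
      available : ∀ w → T w ≡ true → A (match w) ≡ true
      adjacent  : ∀ w → T w ≡ true → E w (match w) ≡ true
      injective : ∀ w w′ → T w ≡ true → T w′ ≡ true → match w ≡ match w′ → w ≡ w′

  Critical : Sub N → Sub k → Sub N → Set
  Critical T A Y = Y ⊆ T × 0 < count Y × count Y < count T × count Y ≡ count (A ∩ nbhd Y)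

  critical? : ∀ T A → Dec (∃ (Critical T A))
  critical? T A = ∃Sub? critical-resp λ Y →
    (Y ⊆? T) ×-dec (0 <? count Y) ×-dec (count Y <? count T) ×-dec (count Y ≟ℕ count (A ∩ nbhd Y))
    where
    critical-resp : Respects≗ (Critical T A)
    critical-resp {Y} {Y′} Y≗Y′ (Y⊆T , pos , proper , tight) =
      (λ w e → Y⊆T w (trans (Y≗Y′ w) e)) ,
      subst (0 <_) |Y|≡ pos , subst (_< count T) |Y|≡ proper ,
      trans (sym |Y|≡) (trans tight (count-ext λ i → cong (A i ∧_) (nbhd-resp Y≗Y′ i)))
      where |Y|≡ = count-ext Y≗Y′

  hall-inside : ∀ {T A S} → HallCondition T A → S ⊆ T → HallCondition S (A ∩ nbhd S)
  hall-inside {A = A} hc S⊆T Y Y⊆S =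
    ≤-trans (hc Y (λ w → S⊆T w ∘ Y⊆S w))
            (count-mono λ i e → let a , n = ∧-true⁻ {A i} e in ∧-true (∧-true a (nbhd-mono Y⊆S i n)) n)

  hall-outside : ∀ {T A S} → HallCondition T A → S ⊆ T → count S ≡ count (A ∩ nbhd S) →
    HallCondition (T ∖ S) (A ∖ nbhd S)
  hall-outside {T} {A} {S} hc S⊆T tight Y Y⊆T∖S = +-cancelʳ-≤ (count S) _ _ (begin
    count Y + count S                          ≡⟨ count-∪ Y S Y∩S=∅ ⟨
    count (Y ∪ S)                              ≤⟨ hc (Y ∪ S) Y∪S⊆T ⟩
    count (A ∩ nbhd (Y ∪ S))                   ≤⟨ count-mono reroute ⟩
    count (((A ∖ nbhd S) ∩ nbhd Y) ∪ (A ∩ nbhd S)) ≡⟨ count-∪ _ _ outside∩inside=∅ ⟩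
    count ((A ∖ nbhd S) ∩ nbhd Y) + count (A ∩ nbhd S) ≡⟨ cong (count ((A ∖ nbhd S) ∩ nbhd Y) +_) tight ⟨
    count ((A ∖ nbhd S) ∩ nbhd Y) + count S    ∎)
    where
    open ≤-Reasoning
    Y∩S=∅ : ∀ w → Y w ≡ true → ¬ (S w ≡ true)
    Y∩S=∅ w y = not-true⁻ (proj₂ (∧-true⁻ {T w} (Y⊆T∖S w y)))
    Y∪S⊆T : (Y ∪ S) ⊆ T
    Y∪S⊆T w e with ∨-true⁻ {Y w} e
    ... | inj₁ y = proj₁ (∧-true⁻ (Y⊆T∖S w y))
    ... | inj₂ s = S⊆T w s
    route : ∀ a y s → a ∧ (y ∨ s) ≡ true → ((a ∧ not s) ∧ y) ∨ (a ∧ s) ≡ true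
    route true true false _ = refl
    route true _ true _ = refl
    reroute : (A ∩ nbhd (Y ∪ S)) ⊆ (((A ∖ nbhd S) ∩ nbhd Y) ∪ (A ∩ nbhd S))
    reroute i e = let a , n = ∧-true⁻ {A i} e in route (A i) (nbhd Y i) (nbhd S i) (∧-true a (nbhd-∪ Y S i n))
    outside∩inside=∅ : ∀ i → ((A ∖ nbhd S) ∩ nbhd Y) i ≡ true → ¬ ((A ∩ nbhd S) i ≡ true)
    outside∩inside=∅ i o n =
      not-true⁻ (proj₂ (∧-true⁻ {A i} (proj₁ (∧-true⁻ {(A ∖ nbhd S) i} o)))) (proj₂ (∧-true⁻ {A i} n))

  merge : ∀ {T A S} → Matching S (A ∩ nbhd S) → Matching (T ∖ S) (A ∖ nbhd S) → Matching T A
  merge {T} {A} {S} M₁ M₂ = record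
    { match = match ; available = available ; adjacent = adjacent ; injective = injective }
    where
    module M₁ = Matching M₁
    module M₂ = Matching M₂
    match : Fin N → Fin k
    match w = if S w then M₁.match w else M₂.match w
    available : ∀ w → T w ≡ true → A (match w) ≡ true
    available w t with S w in s
    ... | true = proj₁ (∧-true⁻ (M₁.available w s))
    ... | false = proj₁ (∧-true⁻ (M₂.available w (∧-true t (cong not s))))
    adjacent : ∀ w → T w ≡ true → E w (match w) ≡ true
    adjacent w t with S w in s
    ... | true = M₁.adjacent w s
    ... | false = M₂.adjacent w (∧-true t (cong not s))
    -- A vertex of S is matched inside nbhd S, any other vertex of T outside it.
    separated : ∀ w w′ → S w ≡ true → T w′ ≡ true → S w′ ≡ false → M₁.match w ≢ M₂.match w′
    separated w w′ s t′ s′ e =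
      not-true⁻ (proj₂ (∧-true⁻ {A (M₂.match w′)} (M₂.available w′ (∧-true t′ (cong not s′)))))
                (subst (λ i → nbhd S i ≡ true) e (proj₂ (∧-true⁻ {A (M₁.match w)} (M₁.available w s))))
    injective : ∀ w w′ → T w ≡ true → T w′ ≡ true → match w ≡ match w′ → w ≡ w′
    injective w w′ t t′ e with S w in s | S w′ in s′
    ... | true | true = M₁.injective w w′ s s′ e
    ... | false | false = M₂.injective w w′ (∧-true t (cong not s)) (∧-true t′ (cong not s′)) e
    ... | true | false = ⊥-elim (separated w w′ s t′ s′ e)
    ... | false | true = ⊥-elim (separated w′ w s′ t s (sym e))

  -- Without critical sets, removing any vertex w₀ of T together with any
  -- right vertex i₀ preserves Hall's condition: each nonempty Y ⊆ T ∖ ⁅ w₀ ⁆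
  -- has strictly more available neighbours than elements.
  hall-remove : ∀ {T A w₀} → HallCondition T A → (∀ Y → ¬ Critical T A Y) → T w₀ ≡ true →
    ∀ i₀ → HallCondition (T ∖ ⁅ w₀ ⁆) (A ∖ ⁅ i₀ ⁆)
  hall-remove {T} {A} {w₀} hc no-critical tw₀ i₀ Y Y⊆ with count Y ≟ℕ 0
  ... | yes |Y|≡0 = subst (_≤ count ((A ∖ ⁅ i₀ ⁆) ∩ nbhd Y)) (sym |Y|≡0) z≤n
  ... | no |Y|≢0 = ≤-pred (begin-strict
    count Y                                          <⟨ surplus ⟩
    count (A ∩ nbhd Y)                               ≡⟨ count-split (A ∩ nbhd Y) ⁅ i₀ ⁆ ⟩
    count ((A ∩ nbhd Y) ∩ ⁅ i₀ ⁆) + count ((A ∩ nbhd Y) ∖ ⁅ i₀ ⁆)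
                                                     ≤⟨ +-mono-≤ (count-mono within-i₀) (count-mono reassoc) ⟩
    count ⁅ i₀ ⁆ + count ((A ∖ ⁅ i₀ ⁆) ∩ nbhd Y)    ≡⟨ cong (_+ count ((A ∖ ⁅ i₀ ⁆) ∩ nbhd Y)) (count-singleton i₀) ⟩
    suc (count ((A ∖ ⁅ i₀ ⁆) ∩ nbhd Y))              ∎)
    where
    open ≤-Reasoning
    Y⊆T : Y ⊆ T
    Y⊆T w = proj₁ ∘ ∧-true⁻ ∘ Y⊆ w
    proper : count Y < count T
    proper = begin-strict
      count Y             ≤⟨ count-mono Y⊆ ⟩
      count (T ∖ ⁅ w₀ ⁆)  <⟨ n<1+n _ ⟩
      suc (count (T ∖ ⁅ w₀ ⁆)) ≡⟨ count-remove T w₀ tw₀ ⟨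
      count T             ∎
    surplus : count Y < count (A ∩ nbhd Y)
    surplus = ≤∧≢⇒< (hc Y Y⊆T) λ tight → no-critical Y (Y⊆T , n≢0⇒n>0 |Y|≢0 , proper , tight)
    within-i₀ : ((A ∩ nbhd Y) ∩ ⁅ i₀ ⁆) ⊆ ⁅ i₀ ⁆
    within-i₀ i = proj₂ ∘ ∧-true⁻ {A i ∧ nbhd Y i}
    reassoc : ((A ∩ nbhd Y) ∖ ⁅ i₀ ⁆) ⊆ ((A ∖ ⁅ i₀ ⁆) ∩ nbhd Y)
    reassoc i e = let an , ¬i₀ = ∧-true⁻ {A i ∧ nbhd Y i} e ; a , n = ∧-true⁻ {A i} an
                  in ∧-true (∧-true a ¬i₀) n

  extend : ∀ {T A w₀ i₀} → Matching (T ∖ ⁅ w₀ ⁆) (A ∖ ⁅ i₀ ⁆) → A i₀ ≡ true → E w₀ i₀ ≡ true →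
    Matching T A
  extend {T} {A} {w₀} {i₀} M a₀ e₀ = record
    { match = match ; available = available ; adjacent = adjacent ; injective = injective }
    where
    module M = Matching M
    match : Fin N → Fin k
    match w = if w ≟ᵇ w₀ then i₀ else M.match w
    rest : ∀ {w} → T w ≡ true → w ≟ᵇ w₀ ≡ false → (T ∖ ⁅ w₀ ⁆) w ≡ true
    rest t ne = ∧-true t (cong not ne)
    available : ∀ w → T w ≡ true → A (match w) ≡ true
    available w t with w ≟ᵇ w₀ in ne
    ... | true = a₀
    ... | false = proj₁ (∧-true⁻ (M.available w (rest t ne)))
    adjacent : ∀ w → T w ≡ true → E w (match w) ≡ true
    adjacent w t with w ≟ᵇ w₀ in ne
    ... | true = subst (λ v → E v i₀ ≡ true) (sym (≟ᵇ-sound ne)) e₀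
    ... | false = M.adjacent w (rest t ne)
    avoids : ∀ {w} → T w ≡ true → w ≟ᵇ w₀ ≡ false → M.match w ≢ i₀
    avoids {w} t ne e = not-true⁻ (proj₂ (∧-true⁻ {A (M.match w)} (M.available w (rest t ne))))
                                  (subst (λ i → M.match w ≟ᵇ i ≡ true) e (≟ᵇ-refl (M.match w)))
    injective : ∀ w w′ → T w ≡ true → T w′ ≡ true → match w ≡ match w′ → w ≡ w′
    injective w w′ t t′ e with w ≟ᵇ w₀ in ne | w′ ≟ᵇ w₀ in ne′
    ... | true | true = trans (≟ᵇ-sound ne) (sym (≟ᵇ-sound ne′))
    ... | false | false = M.injective w w′ (rest t ne) (rest t′ ne′) e
    ... | true | false = ⊥-elim (avoids t′ ne′ (sym e))
    ... | false | true = ⊥-elim (avoids t ne e)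

  empty-matching : ∀ {T A} → count T ≡ 0 → Matching T A
  empty-matching {T} |T|≡0 = record
    { match = λ _ → d₀
    ; available = λ w t → ⊥-elim (absurd w t)
    ; adjacent = λ w t → ⊥-elim (absurd w t)
    ; injective = λ w _ t _ _ → ⊥-elim (absurd w t) }
    where
    absurd : ∀ w → T w ≡ true → ⊥
    absurd w t = <⇒≢ (count-member T w t) (sym |T|≡0)

  -- Hall's theorem, by strong induction on |T| (bounded by b): split along a
  -- critical set if there is one, otherwise match any vertex of T to any
  -- available neighbour and recurse.
  hall : ∀ b T A → count T ≤ b → HallCondition T A → Matching T A
  hall zero T A |T|≤0 hc = empty-matching (n≤0⇒n≡0 |T|≤0)
  hall (suc b) T A |T|≤b hc with critical? T A
  ... | yes (S , S⊆T , pos , proper , tight) =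
    merge (hall b S (A ∩ nbhd S) (≤-pred (≤-trans proper |T|≤b)) (hall-inside hc S⊆T))
          (hall b (T ∖ S) (A ∖ nbhd S) rest≤b (hall-outside hc S⊆T tight))
    where
    rest≤b : count (T ∖ S) ≤ b
    rest≤b = ≤-pred (≤-trans (subst (count (T ∖ S) <_) (sym (count-complement S⊆T)) (m<n+m _ pos)) |T|≤b)
  ... | no no-critical with count T ≟ℕ 0
  ...   | yes |T|≡0 = empty-matching |T|≡0
  ...   | no |T|≢0 = extend (hall b (T ∖ ⁅ w₀ ⁆) (A ∖ ⁅ i₀ ⁆) rest≤b rest-hall) a₀ e₀
    where
    w₀ = proj₁ (count-witness T (n≢0⇒n>0 |T|≢0))
    tw₀ = proj₂ (count-witness T (n≢0⇒n>0 |T|≢0))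
    -- Hall's condition for ⁅ w₀ ⁆ gives an available neighbour i₀ of w₀.
    neighbour : ∃ λ i → (A ∩ nbhd ⁅ w₀ ⁆) i ≡ true
    neighbour = count-witness _ (≤-trans (≤-reflexive (sym (count-singleton w₀)))
                  (hc ⁅ w₀ ⁆ λ w e → subst (λ v → T v ≡ true) (sym (≟ᵇ-sound e)) tw₀))
    i₀ = proj₁ neighbour
    a₀ = proj₁ (∧-true⁻ (proj₂ neighbour))
    e₀ : E w₀ i₀ ≡ true
    e₀ with some-witness _ (proj₂ (∧-true⁻ {A i₀} (proj₂ neighbour)))
    ... | w , pe with ∧-true⁻ {⁅ w₀ ⁆ w} pe
    ... | is-w₀ , e = subst (λ v → E v i₀ ≡ true) (≟ᵇ-sound is-w₀) e
    rest≤b : count (T ∖ ⁅ w₀ ⁆) ≤ b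
    rest≤b = ≤-pred (subst (_≤ suc b) (count-remove T w₀ tw₀) |T|≤b)
    rest-hall = hall-remove hc (λ Y c → no-critical (Y , c)) tw₀ i₀

  hall? : ∀ T A → Dec (HallCondition T A)
  hall? T A = ∀Sub? hall-resp λ Y → (Y ⊆? T) →-dec (count Y ≤? count (A ∩ nbhd Y))
    where
    hall-resp : Respects≗ (λ Y → Y ⊆ T → count Y ≤ count (A ∩ nbhd Y))
    hall-resp {Y} {Y′} Y≗Y′ h Y′⊆T =
      subst₂ _≤_ (count-ext Y≗Y′) (count-ext λ i → cong (A i ∧_) (nbhd-resp Y≗Y′ i))
             (h λ w y → Y′⊆T w (trans (sym (Y≗Y′ w)) y))

module TeamStrategy (G : Graph) (m r k g : ℕ) (d₀ : Fin k) (few : r < m * suc k)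
  (home : Fin g → V G) (region : V G → Fin g)
  (near : ∀ v → home (region v) ≡ v ⊎ Graph.Adj G (home (region v)) v) where

  open Graph G using (n; Adj)

  _↝_ : V G → V G → Set
  p ↝ q = q ≡ p ⊎ Adj p q

  load : Pos G r → V G → ℕ
  load R v = count (λ x → R x ≟ᵇ v)

  heavy : Pos G r → Sub n
  heavy R v = does (m ≤? load R v)

  targets : Fin g → Pos G r → Sub n
  targets j R w = heavy R w ∧ (region w ≟ᵇ j)

  -- When the revolutionaries move from R to R′, spy i of team j (at S i) may
  -- take w if it is at home and w is in its region, or if a revolutionary
  -- moved from S i to w.
  reach : Fin g → Pos G r → Pos G k → Pos G r → V G → Fin k → Bool
  reach j R S R′ w i = (S i ≟ᵇ home j ∧ region w ≟ᵇ j) ∨ some (λ x → R x ≟ᵇ S i ∧ R′ x ≟ᵇ w)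

  module Round (j : Fin g) (R : Pos G r) (S : Pos G k) (R′ : Pos G r) where
    open Hall (reach j R S R′) d₀ public

    module _ (hc : HallCondition (targets j R′) full) where
      open Matching (hall n (targets j R′) full (count-≤ _) hc) public
        renaming (match to partner; adjacent to partner-reaches; injective to partner-injective)
        using ()

  retreat : Fin g → V G → V G
  retreat j p = if region p ≟ᵇ j then home j else p

  destination : Sub n → (V G → Fin k) → V G → Fin k → V G
  destination T f d i with Fin.any? (λ w → (T w Bool.≟ true) ×-dec (f w Fin.≟ i))
  ... | yes (w , _) = w
  ... | no _ = d

  destination-spec : ∀ T f d i →
    (destination T f d i ≡ d × (∀ w → T w ≡ true → f w ≢ i)) ⊎
    (∃ λ w → T w ≡ true × f w ≡ i × destination T f d i ≡ w)
  destination-spec T f d i with Fin.any? (λ w → (T w Bool.≟ true) ×-dec (f w Fin.≟ i))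
  ... | yes (w , t , e) = inj₂ (w , t , e , refl)
  ... | no none = inj₁ (refl , λ w t e → none (w , t , e))

  -- The test
  -- keeps the strategy total on all configurations; under the invariant
  -- below it always succeeds (guarding⇒hall).
  HallHolds : Fin g → Pos G r → Pos G k → Pos G r → Set
  HallHolds j R S R′ = Round.HallCondition j R S R′ (targets j R′) full

  teamMoveBy : ∀ j R S R′ → Dec (HallHolds j R S R′) → Pos G k
  teamMoveBy j R S R′ (no _) = S
  teamMoveBy j R S R′ (yes hc) i =
    destination (targets j R′) (Round.partner j R S R′ hc) (retreat j (S i)) i

  teamMove : Fin g → Pos G r → Pos G k → Pos G r → Pos G k
  teamMove j R S R′ = teamMoveBy j R S R′ (Round.hall? j R S R′ (targets j R′) full)

  from-home : ∀ {p} w → home (region w) ≡ p → p ↝ w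
  from-home w refl with near w
  ... | inj₁ home≡w = inj₁ (sym home≡w)
  ... | inj₂ adj = inj₂ adj

  to-home : ∀ p → p ↝ home (region p)
  to-home p with near p
  ... | inj₁ home≡p = inj₁ home≡p
  ... | inj₂ adj = inj₂ (Graph.sym G adj)

  reach-legal : ∀ {j R S R′ w i} → LegalMove G R R′ → reach j R S R′ w i ≡ true → S i ↝ w
  reach-legal {j} {R} {S} {R′} {w} {i} legal e with ∨-true⁻ {S i ≟ᵇ home j ∧ region w ≟ᵇ j} e
  ... | inj₁ at-home =
    let s≡home , in-region = ∧-true⁻ {S i ≟ᵇ home j} at-home
    in from-home w (trans (cong home (≟ᵇ-sound in-region)) (sym (≟ᵇ-sound s≡home)))
  ... | inj₂ followed =
    let x , from-to = some-witness _ followed ; from , to = ∧-true⁻ {R x ≟ᵇ S i} from-to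
    in subst₂ _↝_ (≟ᵇ-sound from) (≟ᵇ-sound to) (legal x)

  retreat-legal : ∀ j p → p ↝ retreat j p
  retreat-legal j p with region p ≟ᵇ j in e
  ... | false = inj₁ refl
  ... | true = subst (λ q → p ↝ home q) (≟ᵇ-sound e) (to-home p)

  teamMove-legal : ∀ j R S R′ d → LegalMove G R R′ → LegalMove G S (teamMoveBy j R S R′ d)
  teamMove-legal j R S R′ (no _) _ i = inj₁ refl
  teamMove-legal j R S R′ (yes hc) legal i
    with destination-spec (targets j R′) (Round.partner j R S R′ hc) (retreat j (S i)) i
  ... | inj₁ (e , _) rewrite e = retreat-legal j (S i)
  ... | inj₂ (w , t , f≡i , e) rewrite e =
    reach-legal {S = S} legal (subst (λ i → reach j R S R′ w i ≡ true) f≡i (Round.partner-reaches j R S R′ hc w t))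

  record Guarding (j : Fin g) (R : Pos G r) (S : Pos G k) : Set where
    field
      posted   : ∀ i → S i ≡ home j ⊎ targets j R (S i) ≡ true
      distinct : ∀ i i′ → S i ≡ S i′ → S i ≢ home j → i ≡ i′

  Covers : Fin g → Pos G r → Pos G k → Set
  Covers j R S = ∀ v → targets j R v ≡ true → ∃ λ i → S i ≡ v

  heavy-load : ∀ R v → heavy R v ≡ true → m ≤ load R v
  heavy-load R v = decided (m ≤? load R v)

  -- If some set Y of targets had fewer than |Y| reachable
  -- spies, the other spies F are away from home on distinct old heavy
  -- vertices, whose revolutionaries did not move into Y. Then m·|Y| + m·|F|
  -- ≤ r, while |Y| + |F| ≥ k + 1, contradicting r < m·(k + 1).
  guarding⇒hall : ∀ {j R S} R′ → Guarding j R S → HallHolds j R S R′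
  guarding⇒hall {j} {R} {S} R′ guard Y Y⊆T = ≮⇒≥ λ short → <⇒≱ few (too-many short)
    where
    open Guarding guard
    open Round j R S R′ using (nbhd)
    F : Sub k
    F i = not (nbhd Y i)
    occupied : Sub n
    occupied v = some (λ i → F i ∧ S i ≟ᵇ v)
    module _ (short : count (nbhd Y) < count Y) where
      y₀ = count-witness Y (≤-trans (s≤s z≤n) short)
      away : ∀ i → F i ≡ true → S i ≢ home j
      away i f s≡home = not-true⁻ f (some-intro _ (proj₁ y₀) (∧-true (proj₂ y₀)
        (∨-trueˡ (∧-true (subst (λ v → S i ≟ᵇ v ≡ true) s≡home (≟ᵇ-refl (S i)))
                         (proj₂ (∧-true⁻ (Y⊆T _ (proj₂ y₀))))))))
      occupied-heavy : ∀ v → occupied v ≡ true → m ≤ load R v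
      occupied-heavy v o with some-witness _ o
      ... | i , fs with ∧-true⁻ {F i} fs
      ...   | f , at with posted i
      ...     | inj₁ s≡home = ⊥-elim (away i f s≡home)
      ...     | inj₂ t = subst (λ v → m ≤ load R v) (≟ᵇ-sound at) (heavy-load R (S i) (proj₁ (∧-true⁻ t)))
      Y-heavy : ∀ v → Y v ≡ true → m ≤ load R′ v
      Y-heavy v y = heavy-load R′ v (proj₁ (∧-true⁻ (Y⊆T v y)))
      |F|≤|occupied| : count F ≤ count occupied
      |F|≤|occupied| = count-injection F occupied S (λ i f → some-intro _ i (∧-true f (≟ᵇ-refl (S i))))
                         λ i i′ f _ e → distinct i i′ e (away i f)
      separate : ∀ x → Y (R′ x) ≡ true → ¬ (occupied (R x) ≡ true)
      separate x y o with some-witness _ o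
      ... | i , fs with ∧-true⁻ {F i} fs
      ...   | f , at = not-true⁻ f (some-intro _ (R′ x) (∧-true y
                         (∨-trueʳ {S i ≟ᵇ home j ∧ region (R′ x) ≟ᵇ j}
                           (some-intro _ x (∧-true (subst (λ v → R x ≟ᵇ v ≡ true) (sym (≟ᵇ-sound at)) (≟ᵇ-refl (R x)))
                                                   (≟ᵇ-refl (R′ x)))))))
      k<|Y|+|F| : suc k ≤ count Y + count F
      k<|Y|+|F| = begin
        suc k                        ≡⟨ cong suc (trans (sym (count-full k)) (count-split full (nbhd Y))) ⟩
        suc (count (nbhd Y) + count F) ≤⟨ +-monoˡ-≤ (count F) short ⟩
        count Y + count F            ∎
        where open ≤-Reasoning
      too-many : m * suc k ≤ r
      too-many = begin
        m * suc k                                ≤⟨ *-monoʳ-≤ m k<|Y|+|F| ⟩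
        m * (count Y + count F)                  ≡⟨ *-distribˡ-+ m (count Y) (count F) ⟩
        m * count Y + m * count F                ≤⟨ +-monoʳ-≤ (m * count Y) (*-monoʳ-≤ m |F|≤|occupied|) ⟩
        m * count Y + m * count occupied         ≤⟨ +-mono-≤ (count-fibres R′ Y m Y-heavy)
                                                             (count-fibres R occupied m occupied-heavy) ⟩
        count (Y ∘ R′) + count (occupied ∘ R)    ≡⟨ count-∪ (Y ∘ R′) (occupied ∘ R) separate ⟨
        count ((Y ∘ R′) ∪ (occupied ∘ R))        ≤⟨ count-≤ _ ⟩
        r                                        ∎
        where open ≤-Reasoning

  retreat-home : ∀ {j R S} → Guarding j R S → ∀ i → retreat j (S i) ≡ home j
  retreat-home {j} {R} {S} guard i with region (S i) ≟ᵇ j | Guarding.posted guard i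
  ... | true | _ = refl
  ... | false | inj₁ s≡home = s≡home
  ... | false | inj₂ t with () ← proj₂ (∧-true⁻ {heavy R (S i)} t)

  team-step : ∀ {j R S R′} d → Guarding j R S →
    Guarding j R′ (teamMoveBy j R S R′ d) × Covers j R′ (teamMoveBy j R S R′ d)
  team-step {R′ = R′} (no no-hall) guard = ⊥-elim (no-hall (guarding⇒hall R′ guard))
  team-step {j} {R} {S} {R′} (yes hc) guard = record { posted = posted ; distinct = distinct } , covers
    where
    f = Round.partner j R S R′ hc
    S′ = teamMoveBy j R S R′ (yes hc)
    spec = λ i → destination-spec (targets j R′) f (retreat j (S i)) i
    posted : ∀ i → S′ i ≡ home j ⊎ targets j R′ (S′ i) ≡ true
    posted i with spec i
    ... | inj₁ (e , _) = inj₁ (trans e (retreat-home guard i))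
    ... | inj₂ (w , t , _ , e) = inj₂ (subst (λ v → targets j R′ v ≡ true) (sym e) t)
    distinct : ∀ i i′ → S′ i ≡ S′ i′ → S′ i ≢ home j → i ≡ i′
    distinct i i′ same away with spec i | spec i′
    ... | inj₁ (e , _) | _ = ⊥-elim (away (trans e (retreat-home guard i)))
    ... | inj₂ _ | inj₁ (e′ , _) = ⊥-elim (away (trans same (trans e′ (retreat-home guard i′))))
    ... | inj₂ (w , _ , fw , e) | inj₂ (w′ , _ , fw′ , e′) =
      trans (sym fw) (trans (cong f (trans (sym e) (trans same e′))) fw′)
    covers : Covers j R′ S′
    covers v t with spec (f v)
    ... | inj₁ (_ , unmatched) = ⊥-elim (unmatched v t refl)
    ... | inj₂ (w , tw , fw , e) = f v , trans e (Round.partner-injective j R S R′ hc w v tw t fw)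

  team : Pos G (g * k) → Fin g → Pos G k
  team S j i = S (combine j i)

  move : Pos G r → Pos G (g * k) → Pos G r → Pos G (g * k)
  move R S R′ s = teamMove (proj₁ (remQuot {g} k s)) R (team S (proj₁ (remQuot {g} k s))) R′ (proj₂ (remQuot {g} k s))

  team-move : ∀ R S R′ j → team (move R S R′) j ≗ teamMove j R (team S j) R′
  team-move R S R′ j i = cong (λ ji → teamMove (proj₁ ji) R (team S (proj₁ ji)) R′ (proj₂ ji))
                              (Fin.remQuot-combine {g} {k} j i)

  move-legal : ∀ R S R′ → LegalMove G R R′ → LegalMove G S (move R S R′)
  move-legal R S R′ legal s = subst (_↝ move R S R′ s) (cong S (Fin.combine-remQuot {g} k s))
    (teamMove-legal j R (team S j) R′ (Round.hall? j R (team S j) R′ (targets j R′) full) legal (proj₂ (remQuot {g} k s)))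
    where j = proj₁ (remQuot {g} k s)

  Safe : Pos G r → Pos G (g * k) → Set
  Safe R S = ∀ j → Guarding j R (team S j) × Covers j R (team S j)

  guarding-resp : ∀ {j R S S′} → S ≗ S′ → Guarding j R S → Guarding j R S′
  guarding-resp {j} {R} S≗S′ guard = record
    { posted = λ i → subst (λ p → p ≡ home j ⊎ targets j R p ≡ true) (S≗S′ i) (posted i)
    ; distinct = λ i i′ same away →
        distinct i i′ (trans (S≗S′ i) (trans same (sym (S≗S′ i′)))) (away ∘ trans (sym (S≗S′ i))) }
    where open Guarding guard

  covers-resp : ∀ {j R S S′} → S ≗ S′ → Covers j R S → Covers j R S′
  covers-resp S≗S′ covers v t = let i , at = covers v t in i , trans (sym (S≗S′ i)) at

  move-safe : ∀ R S R′ → (∀ j → Guarding j R (team S j)) → Safe R′ (move R S R′)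
  move-safe R S R′ guards j =
    let guard , covers = team-step (Round.hall? j R (team S j) R′ (targets j R′) full) (guards j)
    in guarding-resp (sym ∘ team-move R S R′ j) guard , covers-resp {R = R′} (sym ∘ team-move R S R′ j) covers

  -- Initially all spies stand at home; the opening placement is the move
  -- answering "revolutionaries moving from R₀ to R₀".
  homes : Pos G (g * k)
  homes s = home (proj₁ (remQuot {g} k s))

  homes-guarding : ∀ R j → Guarding j R (team homes j)
  homes-guarding R j = record
    { posted = λ i → inj₁ (at-home i) ; distinct = λ i _ _ away → ⊥-elim (away (at-home i)) }
    where
    at-home : ∀ i → team homes j i ≡ home j
    at-home i = cong (home ∘ proj₁) (Fin.remQuot-combine {g} {k} j i)

  strategy : Game.Strategy G m r (g * k)
  strategy = record
    { init = λ R₀ → move R₀ homes R₀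
    ; step = λ _ c R′ → move (proj₁ c) (proj₂ c) R′
    ; legal = λ _ c R′ → move-legal (proj₁ c) (proj₂ c) R′ }

  safe-play : ∀ ρ t → let c = proj₁ (Game.state G m r (g * k) strategy ρ t) in Safe (proj₁ c) (proj₂ c)
  safe-play ρ zero = move-safe (ρ zero) homes (ρ zero) (homes-guarding (ρ zero))
  safe-play ρ (suc t) with Game.state G m r (g * k) strategy ρ t | safe-play ρ t
  ... | (R , S) , _ | safe = move-safe R S (ρ (suc t)) (proj₁ ∘ safe)

  -- A heavy vertex is a target of its own region's team, hence occupied.
  safe-no-win : ∀ R S → Safe R S → ¬ Game.RevWin G m r (g * k) (R , S)
  safe-no-win R S safe (v , enough , unguarded) = unguarded (combine (region v) i) at
    where
    load≡ : Game.revCount G m r (g * k) R v ≡ load R v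
    load≡ = length-filter (λ x → x) (λ x → R x Fin.≟ v)
    target : targets (region v) R v ≡ true
    target = ∧-true (dec-true (m ≤? load R v) (subst (m ≤_) load≡ enough)) (≟ᵇ-refl (region v))
    i = proj₁ (proj₂ (safe (region v)) v target)
    at = proj₂ (proj₂ (safe (region v)) v target)

  spies-win : Game.SpiesWin G m r (g * k)
  spies-win = strategy , λ ρ _ t → safe-no-win _ _ (safe-play ρ t)

enumerate : ∀ {n} (p : Subset n) → Σ (Fin ∣ p ∣ → Fin n) λ e → ∀ x → x ∈ p → ∃ λ j → e j ≡ x
enumerate [] = (λ ()) , λ _ ()
enumerate (inside ∷ p) with enumerate p
... | e , onto = e′ , onto′
  where
  e′ : Fin (suc ∣ p ∣) → Fin _
  e′ zero = zero
  e′ (suc j) = suc (e j)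
  onto′ : ∀ x → x ∈ inside ∷ p → ∃ λ j → e′ j ≡ x
  onto′ zero _ = zero , refl
  onto′ (suc x) (there x∈p) = let j , ej = onto x x∈p in suc j , cong suc ej
enumerate (outside ∷ p) with enumerate p
... | e , onto = suc ∘ e , onto′
  where
  onto′ : ∀ x → x ∈ outside ∷ p → ∃ λ j → suc (e j) ≡ x
  onto′ (suc x) (there x∈p) = let j , ej = onto x x∈p in j , cong suc ej

module Dominators (G : Graph) (D : Subset (Graph.n G)) (dominating : IsDominating G D) where

  dominator : ∀ v → ∃ λ u → u ∈ D × (u ≡ v ⊎ Graph.Adj G u v)
  dominator v with v ∈? D
  ... | yes v∈D = v , v∈D , inj₁ refl
  ... | no v∉D = let u , u∈D , adj = dominating v v∉D in u , u∈D , inj₂ adj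

  home : Fin ∣ D ∣ → V G
  home = proj₁ (enumerate D)

  indexOf : ∀ v → ∃ λ j → home j ≡ proj₁ (dominator v)
  indexOf v = proj₂ (enumerate D) (proj₁ (dominator v)) (proj₁ (proj₂ (dominator v)))

  region : V G → Fin ∣ D ∣
  region v = proj₁ (indexOf v)

  near : ∀ v → home (region v) ≡ v ⊎ Graph.Adj G (home (region v)) v
  near v = subst (λ u → u ≡ v ⊎ Graph.Adj G u v) (sym (proj₂ (indexOf v))) (proj₂ (proj₂ (dominator v)))

below-next-multiple : ∀ r m .{{_ : NonZero m}} → r < m * suc (r / m)
below-next-multiple r m = begin-strict
  r                      ≡⟨ m≡m%n+[m/n]*n r m ⟩
  r % m + (r / m) * m    <⟨ +-monoˡ-< ((r / m) * m) (m%n<n r m) ⟩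
  m + (r / m) * m        ≡⟨ *-comm (suc (r / m)) m ⟩
  m * suc (r / m)        ∎
  where open ≤-Reasoning

spies-win-by-domination : ∀ (G : Graph) m r k (D : Subset (Graph.n G)) →
  IsDominating G D → 1 ≤ k → r < m * suc k → Game.SpiesWin G m r (∣ D ∣ * k)
spies-win-by-domination G m r k D dominating 1≤k few =
  TeamStrategy.spies-win G m r k ∣ D ∣ (fromℕ< 1≤k) few home region near
  where open Dominators G D dominating

corollary3p4 : (G : Graph) (m r : ℕ) .{{_ : Data.Nat.NonZero m}} →
    1 ≤ m → 1 ≤ r →
    r ∸ m + 1 ≤ Graph.n G → r / m ≤ r ∸ m + 1 → 1 ≤ r / m →
    ∀ g s → IsDominationNumber G g → IsSigma G m r s →
    s ≤ g * (r / m)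
corollary3p4 G m r _ _ _ _ 1≤r/m g s ((D , dominating , |D|≡g) , _) (_ , minimal) =
  ≮⇒≥ λ g[r/m]<s → minimal (g * (r / m)) g[r/m]<s
    (subst (λ d → Game.SpiesWin G m r (d * (r / m))) |D|≡g
      (spies-win-by-domination G m r (r / m) D dominating 1≤r/m (below-next-multiple r m)))
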